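{- Let $\sigma\in\mathfrak{S}_n$ have rix-factorization $\alpha_1\alpha_2\cdots\alpha_i\alpha_{i+1}$, where $\alpha_{i+1}=\beta$. For any $x\in[n]$, if $x$ is a letter of $\alpha_k$ ($1\le k\le i+1$), then the rix-factorization of $\varphi''_x(\sigma)$ is $\alpha_1\cdots\alpha_{k-1}\alpha'_k\alpha_{k+1}\cdots\alpha_{i+1}$, where $\alpha'_k$ is a rearrangement of $\alpha_k$. Moreover, $\beta_1(\varphi''_x(\sigma))=\beta_1(\sigma)$ and $\mathrm{RIX}(\varphi''_x(\sigma))=\mathrm{RIX}(\sigma)$.
   Context: For $\sigma=\sigma_1\cdots\sigma_n\in\mathfrak{S}_n$, with $\sigma_0=\sigma_{n+1}=+\infty$: $\sigma_i$ is a double descent / double ascent / peak / valley if $\sigma_{i-1}>\sigma_i>\sigma_{i+1}$ / $\sigma_{i-1}<\sigma_i<\sigma_{i+1}$ / $\sigma_{i-1}<\sigma_i>\sigma_{i+1}$ / $\sigma_{i-1}>\sigma_i<\sigma_{i+1}$. For $x\in[n]$ write $\sigma=w_1w_2xw_3w_4$ where $w_2$ (resp. $w_3$) is the maximal contiguous subword immediately left (resp. right) of $x$ with all letters smaller than $x$; $\varphi'_x(\sigma)=w_1w_3xw_2w_4$ if $x$ is a double ascent or double descent, and $\varphi'_x(\sigma)=\sigma$ if $x$ is a peak or valley. Words have distinct letters; $w_i$ is a descent top if $w_i>w_{i+1}$; a length-1 word is an L-hook; a word of length $\ge2$ is an L-hook (resp. F-hook) if its last (resp. first) letter is its greatest.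 The rix-factorization $\sigma=\alpha_1\cdots\alpha_i\beta$ is produced by: $w\leftarrow\sigma$, $i\leftarrow0$; if $w$ is increasing, $\beta=w$, stop; else $i\leftarrow i+1$, $x$ = greatest descent top of $w$, $w=w'xw''$; if $w'$ empty, $\beta=w$, stop; else $\alpha_i=w'x$, $w\leftarrow w''$, repeat. $\beta_1(\sigma)$ is the first letter of $\beta$; $\mathrm{RIX}(\sigma)$ is the set of letters of the maximal increasing suffix of $\beta$ that are $\ge\beta_1(\sigma)$. Define $\varphi''_x(\sigma)=\sigma$ if $x\in\{\beta_1(\sigma)\}\cup\mathrm{RIX}(\sigma)$, and $\varphi''_x(\sigma)=\varphi'_x(\sigma)$ otherwise. -}

module Defs where

open import Data.Bool using (Bool; true; false; if_then_else_; _∧_; _∨_; not)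
open import Data.Nat using (ℕ; zero; suc; _<ᵇ_; _≡ᵇ_; _⊔_)
open import Data.List using (List; []; _∷_; _++_; [_]; map; upTo; reverse; takeWhileᵇ; dropWhileᵇ; head; last; length; filterᵇ)
open import Data.Bool.ListAction using (any)
open import Data.Maybe using (Maybe; just; nothing)
open import Data.Product using (_×_; _,_; proj₁; proj₂)

-- [n] = 1,2,...,n  (a permutation of [n] is a list σ with σ ↭ range n)
range : ℕ → List ℕ
range n = map suc (upTo n)

descentTops : List ℕ → List ℕ
descentTops (a ∷ b ∷ w) = if b <ᵇ a then a ∷ descentTops (b ∷ w) else descentTops (b ∷ w)
descentTops _ = []

maxList : ℕ → List ℕ → ℕ
maxList d [] = d
maxList d (e ∷ es) = maxList (d ⊔ e) es

splitAtLetter : ℕ → List ℕ → List ℕ × List ℕ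
splitAtLetter x [] = [] , []
splitAtLetter x (a ∷ w) =
  if a ≡ᵇ x then ([] , w)
  else (a ∷ proj₁ (splitAtLetter x w) , proj₂ (splitAtLetter x w))

-- rix-factorization  σ = α₁ ⋯ αᵢ β, returned as (α₁ ∷ ⋯ ∷ αᵢ ∷ [] , β).
-- The fuel argument is only for termination: each round removes at
-- least one letter, so fuel = length w suffices.

rixAux : ℕ → List ℕ → List (List ℕ) × List ℕ
rixAux zero w = [] , w
rixAux (suc fuel) w with descentTops w
... | [] = [] , w
... | d ∷ ds with splitAtLetter (maxList d ds) w
...   | [] , w'' = [] , w
...   | (a ∷ w') , w'' =
          ((a ∷ w') ++ [ maxList d ds ]) ∷ proj₁ (rixAux fuel w'') , proj₂ (rixAux fuel w'')

rix : List ℕ → List (List ℕ) × List ℕ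
rix w = rixAux (length w) w

rixFactors : List ℕ → List (List ℕ)
rixFactors σ = proj₁ (rix σ) ++ [ proj₂ (rix σ) ]

rixβ : List ℕ → List ℕ
rixβ σ = proj₂ (rix σ)

β₁ : List ℕ → Maybe ℕ
β₁ σ = head (rixβ σ)

decPrefix : List ℕ → List ℕ
decPrefix [] = []
decPrefix (a ∷ []) = a ∷ []
decPrefix (a ∷ b ∷ w) = if b <ᵇ a then a ∷ decPrefix (b ∷ w) else a ∷ []

incSuffix : List ℕ → List ℕ
incSuffix w = reverse (decPrefix (reverse w))

geq : Maybe ℕ → ℕ → Bool
geq nothing  y = false
geq (just b) y = not (y <ᵇ b)

-- RIX(σ) (as a list; compared as a set in the statement)
RIX : List ℕ → List ℕ
RIX σ = filterᵇ (geq (β₁ σ)) (incSuffix (rixβ σ))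

-- left neighbour < x  (left sentinel +∞ : false)
leftLess : ℕ → Maybe ℕ → Bool
leftLess x nothing  = false
leftLess x (just l) = l <ᵇ x

-- x < right neighbour (right sentinel +∞ : true)
rightGreater : ℕ → Maybe ℕ → Bool
rightGreater x nothing  = true
rightGreater x (just r) = x <ᵇ r

leftGreater : ℕ → Maybe ℕ → Bool
leftGreater x nothing  = true
leftGreater x (just l) = x <ᵇ l

rightLess : ℕ → Maybe ℕ → Bool
rightLess x nothing  = false
rightLess x (just r) = r <ᵇ x

isDoubleAscent : ℕ → List ℕ → Bool
isDoubleAscent x σ = leftLess x (last (proj₁ (splitAtLetter x σ)))
                   ∧ rightGreater x (head (proj₂ (splitAtLetter x σ)))

isDoubleDescent : ℕ → List ℕ → Bool
isDoubleDescent x σ = leftGreater x (last (proj₁ (splitAtLetter x σ)))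
                    ∧ rightLess x (head (proj₂ (splitAtLetter x σ)))

move : ℕ → List ℕ → List ℕ
move x σ = w₁ ++ w₃ ++ x ∷ w₂ ++ w₄
  where
  pre  = proj₁ (splitAtLetter x σ)
  post = proj₂ (splitAtLetter x σ)
  w₂ = reverse (takeWhileᵇ (_<ᵇ x) (reverse pre))
  w₁ = reverse (dropWhileᵇ (_<ᵇ x) (reverse pre))
  w₃ = takeWhileᵇ (_<ᵇ x) post
  w₄ = dropWhileᵇ (_<ᵇ x) post

φ′ : ℕ → List ℕ → List ℕ
φ′ x σ = if isDoubleAscent x σ ∨ isDoubleDescent x σ then move x σ else σ

elemᵇ : ℕ → List ℕ → Bool
elemᵇ x = any (_≡ᵇ x)

isβ₁ : ℕ → Maybe ℕ → Bool
isβ₁ x nothing  = false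
isβ₁ x (just b) = b ≡ᵇ x

φ″ : ℕ → List ℕ → List ℕ
φ″ x σ = if isβ₁ x (β₁ σ) ∨ elemᵇ x (RIX σ) then σ else φ′ x σ

-- Each round of the rix-factorization cuts the word just after its greatest
-- descent top m, unless m is the first letter, in which case the word is β.
-- If φ″ moves x, then x is neither β₁ nor in RIX, and φ′ swaps the maximal
-- blocks w₂, w₃ of letters smaller than x around x; the block w₂ x w₃ is
-- flanked by larger letters.  Hence descent tops above x are the same before
-- and after the swap, and x, being a double ascent or descent, can be the
-- greatest descent top only as the first letter, where it would be β₁.  As a
-- letter above every descent top ends up as β₁ or in RIX, each round picks the
-- same m > x on both sides.  If m precedes the block, the same factor is cut
-- off, or the word is β on both sides with the same first letter m and the
-- same letters above m in its increasing tail; if m follows the block, the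
-- block lies in the factor ending at m, which is merely rearranged, and the
-- rest of the word is untouched.

module Submission where

open import Defs
open import Data.Bool using (Bool; true; false; T; _∧_; _∨_; if_then_else_)
open import Data.Bool.Properties using (T-≡; ∨-zeroʳ)
open import Data.Empty using (⊥; ⊥-elim)
open import Data.List
  using (List; []; _∷_; _++_; [_]; reverse; head; last; length; filterᵇ; concat; takeWhileᵇ; dropWhileᵇ)
open import Data.List.Properties
  using (∷-injective; ++-assoc; ++-identityʳ; reverse-++; reverse-involutive; unfold-reverse; length-++;
         takeWhile++dropWhile)
open import Data.List.Membership.Propositional using (_∈_; _∉_)
open import Data.List.Membership.Propositional.Properties
  using (∈-++⁺ˡ; ∈-++⁺ʳ; ∈-++⁻; ∈-∃++; ∈-concat⁺′; ∈-filter⁺; ∈-filter⁻)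
open import Data.List.Relation.Unary.All as All using (All; []; _∷_)
import Data.List.Relation.Unary.All.Properties as All
open import Data.List.Relation.Unary.Any using (here; there)
import Data.List.Relation.Unary.Any.Properties as Any
open import Data.List.Relation.Unary.Linked using (Linked; [-]; _∷_)
open import Data.List.Relation.Unary.Linked.Properties using (Linked⇒All)
open import Data.List.Relation.Unary.AllPairs using (_∷_)
open import Data.List.Relation.Unary.Unique.Propositional using (Unique)
import Data.List.Relation.Unary.Unique.Propositional.Properties as Unique
open import Data.List.Relation.Binary.Permutation.Propositional using (_↭_; ↭-refl; ↭-sym; ↭-trans; ↭⇒↭ₛ; prep)
open import Data.List.Relation.Binary.Permutation.Propositional.Properties
  using (++⁺ˡ; ++⁺ʳ; All-resp-↭; ∈-resp-↭; shift; ↭-length) renaming (++-comm to ↭-++-comm)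
import Data.List.Relation.Binary.Permutation.Setoid.Properties as Permutationₛ
open import Data.Maybe using (just; nothing)
open import Data.Nat using (ℕ; zero; suc; z<s; _≤_; _<_; _>_; _<ᵇ_; _≡ᵇ_; _⊔_)
open import Data.Nat.Properties
open import Data.Product using (_×_; _,_; proj₁; proj₂; ∃; ∃₂)
open import Data.Product.Function.NonDependent.Propositional using (_×-⇔_)
open import Data.Sum using (_⊎_; inj₁; inj₂)
open import Data.Unit using (⊤; tt)
open import Function using (_∘_; case_of_)
open import Function.Bundles using (_⇔_; mk⇔; Equivalence)
open import Function.Construct.Composition using (_⇔-∘_)
open import Function.Construct.Identity using (⇔-id)
open import Function.Construct.Symmetry using (⇔-sym)
open import Relation.Binary.PropositionalEquality
  using (module ≡-Reasoning; _≡_; _≢_; refl; sym; trans; cong; cong₂; subst; subst₂; setoid)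
open ≡-Reasoning
open import Relation.Nullary using (¬_; yes; no)
open import Relation.Nullary.Decidable using (T?)
open import Relation.Binary.Definitions using (tri<; tri≈; tri>)

<⇒<ᵇ≡true : ∀ {a b} → a < b → (a <ᵇ b) ≡ true
<⇒<ᵇ≡true {a} {b} a<b with a <ᵇ b in eq
... | true  = refl
... | false = ⊥-elim (subst T eq (<⇒<ᵇ a<b))

≮⇒<ᵇ≡false : ∀ {a b} → ¬ a < b → (a <ᵇ b) ≡ false
≮⇒<ᵇ≡false {a} {b} a≮b with a <ᵇ b in eq
... | true  = ⊥-elim (a≮b (<ᵇ⇒< a b (Equivalence.from T-≡ eq)))
... | false = refl

<ᵇ≡true⇒< : ∀ {a b} → (a <ᵇ b) ≡ true → a < b
<ᵇ≡true⇒< {a} {b} eq = <ᵇ⇒< a b (Equivalence.from T-≡ eq)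

<ᵇ≡false⇒≮ : ∀ {a b} → (a <ᵇ b) ≡ false → ¬ a < b
<ᵇ≡false⇒≮ eq a<b = subst T eq (<⇒<ᵇ a<b)

≡ᵇ-refl : ∀ n → (n ≡ᵇ n) ≡ true
≡ᵇ-refl zero    = refl
≡ᵇ-refl (suc n) = ≡ᵇ-refl n

≢⇒≡ᵇ≡false : ∀ {a b} → a ≢ b → (a ≡ᵇ b) ≡ false
≢⇒≡ᵇ≡false {a} {b} a≢b with a ≡ᵇ b in eq
... | true  = ⊥-elim (a≢b (≡ᵇ⇒≡ a b (Equivalence.from T-≡ eq)))
... | false = refl

≡ᵇ≡true⇒≡ : ∀ {a b} → (a ≡ᵇ b) ≡ true → a ≡ b
≡ᵇ≡true⇒≡ {a} {b} eq = ≡ᵇ⇒≡ a b (Equivalence.from T-≡ eq)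

private
  variable
    X : Set

[]≢++∷ : ∀ (u : List X) {m v} → [] ≢ u ++ m ∷ v
[]≢++∷ []      ()
[]≢++∷ (_ ∷ _) ()

∈⇒≢[] : ∀ {x : X} {xs} → x ∈ xs → xs ≢ []
∈⇒≢[] x∈ refl = Any.¬Any[] x∈

∈⇒0<length : ∀ {x : X} {xs} → x ∈ xs → 0 < length xs
∈⇒0<length (here _)  = z<s
∈⇒0<length (there _) = z<s

≤-length-after : ∀ (u : List X) {m v f} → length (u ++ m ∷ v) ≤ suc f → length v ≤ f
≤-length-after u {m} {v} le rewrite length-++ u {m ∷ v} =
  ≤-pred (≤-trans (m≤n+m (suc (length v)) (length u)) le)

Unique-resp-↭ : ∀ {X : Set} {xs ys : List X} → xs ↭ ys → Unique xs → Unique ys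
Unique-resp-↭ {X} p = Permutationₛ.Unique-resp-↭ (setoid X) (↭⇒↭ₛ p)

Unique-++⁻ʳ : ∀ P {Q : List X} → Unique (P ++ Q) → Unique Q
Unique-++⁻ʳ []      u       = u
Unique-++⁻ʳ (_ ∷ P) (_ ∷ u) = Unique-++⁻ʳ P u

Unique-++⇒disjoint : ∀ P {Q : List X} {y} → Unique (P ++ Q) → y ∈ P → y ∉ Q
Unique-++⇒disjoint (_ ∷ P) (p∉ ∷ _) (here refl) y∈Q = All.lookup (All.++⁻ʳ P p∉) y∈Q refl
Unique-++⇒disjoint (_ ∷ P) (_ ∷ u)  (there y∈P) y∈Q = Unique-++⇒disjoint P u y∈P y∈Q

Unique-middle-∉ˡ : ∀ P {x : X} {Q} → Unique (P ++ x ∷ Q) → x ∉ P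
Unique-middle-∉ˡ P u x∈P = Unique-++⇒disjoint P u x∈P (here refl)

Unique-middle-∉ʳ : ∀ P {x : X} {Q} → Unique (P ++ x ∷ Q) → x ∉ Q
Unique-middle-∉ʳ P u x∈Q with Unique-++⁻ʳ P u
... | x∉Q ∷ _ = All.lookup x∉Q x∈Q refl

Unique-after-middle : ∀ P {x : X} {Q} → Unique (P ++ x ∷ Q) → Unique Q
Unique-after-middle P u with _ ∷ uQ ← Unique-++⁻ʳ P u = uQ

++-cancel-at-∉ : ∀ (P P′ : List X) {x Q Q′} → x ∉ P → x ∉ P′ →
                 P ++ x ∷ Q ≡ P′ ++ x ∷ Q′ → P ≡ P′ × Q ≡ Q′
++-cancel-at-∉ []      []       _   _    refl = refl , refl
++-cancel-at-∉ []      (_ ∷ _)  _   x∉P′ eq with refl , _ ← ∷-injective eq = ⊥-elim (x∉P′ (here refl))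
++-cancel-at-∉ (_ ∷ _) []       x∉P _    eq with refl , _ ← ∷-injective eq = ⊥-elim (x∉P (here refl))
++-cancel-at-∉ (p ∷ P) (_ ∷ P′) x∉P x∉P′ eq
  with refl , eq′ ← ∷-injective eq
  with refl , refl ← ++-cancel-at-∉ P P′ (x∉P ∘ there) (x∉P′ ∘ there) eq′ = refl , refl

splitAtLetter-∉ : ∀ P {m Q} → m ∉ P → splitAtLetter m (P ++ m ∷ Q) ≡ (P , Q)
splitAtLetter-∉ [] {m} _ rewrite ≡ᵇ-refl m = refl
splitAtLetter-∉ (p ∷ P) {m} {Q} m∉P
  rewrite ≢⇒≡ᵇ≡false (m∉P ∘ here ∘ sym) | splitAtLetter-∉ P {m} {Q} (m∉P ∘ there) = refl

splitAtLetter-∈ : ∀ W {m} → m ∈ W → W ≡ proj₁ (splitAtLetter m W) ++ m ∷ proj₂ (splitAtLetter m W)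
splitAtLetter-∈ (a ∷ W) {m} m∈ with a ≡ᵇ m in eq | m∈
... | true  | _          = cong (_∷ W) (≡ᵇ≡true⇒≡ eq)
... | false | here refl  = ⊥-elim (subst T eq (≡⇒≡ᵇ m m refl))
... | false | there m∈W  = cong (a ∷_) (splitAtLetter-∈ W m∈W)

-- Descent tops

data DescentTop (t : ℕ) : List ℕ → Set where
  this  : ∀ {s Q} → s < t → DescentTop t (t ∷ s ∷ Q)
  later : ∀ {a W} → DescentTop t W → DescentTop t (a ∷ W)

∈-descentTops-∷∷⁻ : ∀ a b W c → (b <ᵇ a) ≡ c → ∀ {t} →
  t ∈ (if c then a ∷ descentTops (b ∷ W) else descentTops (b ∷ W)) → DescentTop t (a ∷ b ∷ W)
∈-descentTops-∷∷⁻ a b W       true  b<a (here refl) = this (<ᵇ≡true⇒< b<a)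
∈-descentTops-∷∷⁻ a b (c ∷ W) true  _   (there t∈)  = later (∈-descentTops-∷∷⁻ b c W (c <ᵇ b) refl t∈)
∈-descentTops-∷∷⁻ a b (c ∷ W) false _   t∈          = later (∈-descentTops-∷∷⁻ b c W (c <ᵇ b) refl t∈)

∈-descentTops⁻ : ∀ W {t} → t ∈ descentTops W → DescentTop t W
∈-descentTops⁻ (a ∷ b ∷ W) = ∈-descentTops-∷∷⁻ a b W (b <ᵇ a) refl

∈-descentTops⁺ : ∀ {t W} → DescentTop t W → t ∈ descentTops W
∈-descentTops⁺ (this s<t) rewrite <⇒<ᵇ≡true s<t = here refl
∈-descentTops⁺ (later {a} {b ∷ W} d) with b <ᵇ a
... | true  = there (∈-descentTops⁺ d)
... | false = ∈-descentTops⁺ d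

DescentTop-++⁺ : ∀ P {t W} → DescentTop t W → DescentTop t (P ++ W)
DescentTop-++⁺ []      d = d
DescentTop-++⁺ (_ ∷ P) d = later (DescentTop-++⁺ P d)

DescentTop-∷⁻ : ∀ {t a W} → DescentTop t (a ∷ W) →
                (t ≡ a × ∃₂ λ s Q → W ≡ s ∷ Q × s < t) ⊎ DescentTop t W
DescentTop-∷⁻ (this s<t) = inj₁ (refl , _ , _ , refl , s<t)
DescentTop-∷⁻ (later d)  = inj₂ d

DescentTop⇒∈ : ∀ {t W} → DescentTop t W → t ∈ W
DescentTop⇒∈ (this _)  = here refl
DescentTop⇒∈ (later d) = there (DescentTop⇒∈ d)

DescentTop-split : ∀ {t W} → DescentTop t W → ∃₂ λ u s → ∃ λ Q → W ≡ u ++ t ∷ s ∷ Q × s < t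
DescentTop-split (this s<t) = [] , _ , _ , refl , s<t
DescentTop-split (later {a} d) with u , s , Q , refl , s<t ← DescentTop-split d = a ∷ u , s , Q , refl , s<t

NoDescent : List ℕ → Set
NoDescent W = ∀ t → ¬ DescentTop t W

IsGreatestTop : ℕ → List ℕ → Set
IsGreatestTop m W = DescentTop m W × (∀ t → DescentTop t W → t ≤ m)

maxList-∈ : ∀ d ds → maxList d ds ∈ d ∷ ds
maxList-∈ d [] = here refl
maxList-∈ d (e ∷ es) with maxList-∈ (d ⊔ e) es
... | there m∈ = there (there m∈)
... | here eq with ⊔-sel d e
...   | inj₁ d⊔e≡d = here (trans eq d⊔e≡d)
...   | inj₂ d⊔e≡e = there (here (trans eq d⊔e≡e))

≤-maxList : ∀ d ds {y} → y ∈ d ∷ ds → y ≤ maxList d ds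
≤-maxList d []       (here refl)         = ≤-refl
≤-maxList d (e ∷ es) (here refl)         = ≤-trans (m≤m⊔n d e) (≤-maxList (d ⊔ e) es (here refl))
≤-maxList d (e ∷ es) (there (here refl)) = ≤-trans (m≤n⊔m d e) (≤-maxList (d ⊔ e) es (here refl))
≤-maxList d (e ∷ es) (there (there y∈)) = ≤-maxList (d ⊔ e) es (there y∈)

maxList-DescentTop : ∀ {W d ds} → descentTops W ≡ d ∷ ds → DescentTop (maxList d ds) W
maxList-DescentTop {W} {d} {ds} eq = ∈-descentTops⁻ W (subst (_ ∈_) (sym eq) (maxList-∈ d ds))

NoDescent⊎greatestTop : ∀ W → NoDescent W ⊎ ∃ λ m → IsGreatestTop m W
NoDescent⊎greatestTop W with descentTops W in eq
... | []     = inj₁ λ t d → Any.¬Any[] (subst (t ∈_) eq (∈-descentTops⁺ d))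
... | d ∷ ds = inj₂ (maxList d ds , maxList-DescentTop eq , λ t dt → ≤-maxList d ds (subst (t ∈_) eq (∈-descentTops⁺ dt)))

greatestTop≡maxList : ∀ {W m d ds} → descentTops W ≡ d ∷ ds → IsGreatestTop m W → maxList d ds ≡ m
greatestTop≡maxList {m = m} {d} {ds} eq (top , greatest) =
  ≤-antisym (greatest _ (maxList-DescentTop eq))
            (≤-maxList d ds (subst (m ∈_) eq (∈-descentTops⁺ top)))

rixAux-NoDescent : ∀ f {W} → NoDescent W → rixAux (suc f) W ≡ ([] , W)
rixAux-NoDescent f {W} none with descentTops W in eq
... | []     = refl
... | d ∷ ds = ⊥-elim (none d (∈-descentTops⁻ W (subst (d ∈_) (sym eq) (here refl))))

rixAux-greatestTop-first : ∀ f {m v} → IsGreatestTop m (m ∷ v) → rixAux (suc f) (m ∷ v) ≡ ([] , m ∷ v)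
rixAux-greatestTop-first f {m} {v} gm with descentTops (m ∷ v) in eq
... | []     = ⊥-elim (Any.¬Any[] (subst (m ∈_) eq (∈-descentTops⁺ (proj₁ gm))))
... | d ∷ ds with refl ← greatestTop≡maxList eq gm rewrite splitAtLetter-∉ [] {m} {v} (λ ()) = refl

factorsOf : List (List ℕ) × List ℕ → List (List ℕ)
factorsOf r = proj₁ r ++ [ proj₂ r ]

_∷ᶠ_ : List ℕ → List (List ℕ) × List ℕ → List (List ℕ) × List ℕ
α ∷ᶠ r = α ∷ proj₁ r , proj₂ r

rixAux-greatestTop-cut : ∀ f u {m v} → m ∉ u → u ≢ [] → IsGreatestTop m (u ++ m ∷ v) →
  rixAux (suc f) (u ++ m ∷ v) ≡ (u ++ [ m ]) ∷ᶠ rixAux f v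
rixAux-greatestTop-cut f [] _ u≢[] _ = ⊥-elim (u≢[] refl)
rixAux-greatestTop-cut f u@(_ ∷ _) {m} {v} m∉u _ gm with descentTops (u ++ m ∷ v) in eq
... | []     = ⊥-elim (Any.¬Any[] (subst (m ∈_) eq (∈-descentTops⁺ (proj₁ gm))))
... | d ∷ ds with refl ← greatestTop≡maxList eq gm rewrite splitAtLetter-∉ u {m} {v} m∉u = refl

concat-rixAux : ∀ f W → concat (factorsOf (rixAux f W)) ≡ W
concat-rixAux zero W = ++-identityʳ W
concat-rixAux (suc f) W with descentTops W in eq
... | [] = ++-identityʳ W
... | d ∷ ds with splitAtLetter (maxList d ds) W in split
...   | [] , v    = ++-identityʳ W
...   | a ∷ u , v rewrite concat-rixAux f v =
  trans (++-assoc (a ∷ u) [ maxList d ds ] v)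
        (sym (trans (splitAtLetter-∈ W top∈W) (cong (λ p → proj₁ p ++ maxList d ds ∷ proj₂ p) split)))
  where
  top∈W : maxList d ds ∈ W
  top∈W = DescentTop⇒∈ (maxList-DescentTop eq)

Ascending : List ℕ → Set
Ascending = Linked _<_

Ascending⇒All< : ∀ {a R} → Ascending (a ∷ R) → All (a <_) R
Ascending⇒All< [-]        = []
Ascending⇒All< (a<b ∷ ab) = Linked⇒All <-trans a<b ab

ascending-above-tops : ∀ P {y Q} → Unique (P ++ y ∷ Q) →
  (∀ t → DescentTop t (P ++ y ∷ Q) → t < y) → Ascending (y ∷ Q)
ascending-above-tops P {y} {[]}    _ _ = [-]
ascending-above-tops P {y} {s ∷ Q} u below with s <? y
... | yes s<y = ⊥-elim (<-irrefl refl (below y (DescentTop-++⁺ P (this s<y))))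
... | no  s≮y = y<s ∷ ascending-above-tops (P ++ [ y ]) u′ below′
  where
  y<s : y < s
  y<s = ≤∧≢⇒< (≮⇒≥ s≮y) (λ y≡s → Unique-middle-∉ʳ P u (here y≡s))
  regroup : P ++ y ∷ s ∷ Q ≡ (P ++ [ y ]) ++ s ∷ Q
  regroup = sym (++-assoc P [ y ] (s ∷ Q))
  u′ : Unique ((P ++ [ y ]) ++ s ∷ Q)
  u′ = subst Unique regroup u
  below′ : ∀ t → DescentTop t ((P ++ [ y ]) ++ s ∷ Q) → t < s
  below′ t d = <-trans (below t (subst (DescentTop t) (sym regroup) d)) y<s

-- A letter before the greatest descent top m that exceeded m would start
-- an increasing run reaching m.
before-greatestTop-< : ∀ u {m v} → Unique (u ++ m ∷ v) →
  (∀ t → DescentTop t (u ++ m ∷ v) → t ≤ m) → All (_< m) u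
before-greatestTop-< u {m} {v} uW greatest = All.tabulate below
  where
  below : ∀ {a} → a ∈ u → a < m
  below {a} a∈u with <-cmp a m
  ... | tri< a<m _ _   = a<m
  ... | tri≈ _ refl _  = ⊥-elim (Unique-middle-∉ˡ u uW a∈u)
  ... | tri> _ _ m<a with u₁ , u₂ , refl ← ∈-∃++ a∈u =
    ⊥-elim (<-asym m<a (All.lookup (Ascending⇒All< run) (∈-++⁺ʳ u₂ (here refl))))
    where
    regroup : (u₁ ++ a ∷ u₂) ++ m ∷ v ≡ u₁ ++ a ∷ (u₂ ++ m ∷ v)
    regroup = ++-assoc u₁ (a ∷ u₂) (m ∷ v)
    run : Ascending (a ∷ u₂ ++ m ∷ v)
    run = ascending-above-tops u₁ (subst Unique regroup uW)
            (λ t d → ≤-<-trans (greatest t (subst (DescentTop t) (sym regroup) d)) m<a)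

Descending : List ℕ → Set
Descending = Linked _>_

decPrefix-head : ∀ y rest → y ∈ decPrefix (y ∷ rest)
decPrefix-head y []      = here refl
decPrefix-head y (b ∷ _) with b <ᵇ y
... | true  = here refl
... | false = here refl

decPrefix-∈⁺ : ∀ {y} D rest → Descending (D ++ [ y ]) → y ∈ decPrefix (D ++ y ∷ rest)
decPrefix-∈⁺ []          rest _           = decPrefix-head _ rest
decPrefix-∈⁺ (d ∷ [])    rest (y<d ∷ _)   rewrite <⇒<ᵇ≡true y<d = there (decPrefix-head _ rest)
decPrefix-∈⁺ (d ∷ e ∷ D) rest (e<d ∷ dec) rewrite <⇒<ᵇ≡true e<d = there (decPrefix-∈⁺ (e ∷ D) rest dec)

decPrefix-≤head : ∀ b w {y} → y ∈ decPrefix (b ∷ w) → y ≤ b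
decPrefix-≤head b []      (here refl) = ≤-refl
decPrefix-≤head b (c ∷ w) y∈ with c <ᵇ b in c<b | y∈
... | true  | here refl = ≤-refl
... | true  | there y∈′ = <⇒≤ (≤-<-trans (decPrefix-≤head c w y∈′) (<ᵇ≡true⇒< c<b))
... | false | here refl = ≤-refl

decPrefix-∈⁻ : ∀ R {y} → y ∈ decPrefix R → ∃₂ λ D₁ D₂ → R ≡ D₁ ++ y ∷ D₂ × All (y <_) D₁
decPrefix-∈⁻ (a ∷ [])    (here refl) = [] , [] , refl , []
decPrefix-∈⁻ (a ∷ b ∷ w) y∈ with b <ᵇ a in b<a | y∈
... | false | here refl = [] , b ∷ w , refl , []
... | true  | here refl = [] , b ∷ w , refl , []
... | true  | there y∈′ with D₁ , D₂ , eq , above ← decPrefix-∈⁻ (b ∷ w) y∈′ =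
  a ∷ D₁ , D₂ , cong (a ∷_) eq , ≤-<-trans (decPrefix-≤head b w y∈′) (<ᵇ≡true⇒< b<a) ∷ above

Descending-∷ʳ : ∀ {q y} D → Descending (D ++ [ q ]) → y < q → Descending ((D ++ [ q ]) ++ [ y ])
Descending-∷ʳ []          [-]         y<q = y<q ∷ [-]
Descending-∷ʳ (d ∷ [])    (q<d ∷ [-]) y<q = q<d ∷ y<q ∷ [-]
Descending-∷ʳ (d ∷ e ∷ D) (e<d ∷ dec) y<q = e<d ∷ Descending-∷ʳ (e ∷ D) dec y<q

Ascending-reverse : ∀ {y} Q → Ascending (y ∷ Q) → Descending (reverse Q ++ [ y ])
Ascending-reverse []      _          = [-]
Ascending-reverse (q ∷ Q) (y<q ∷ asc) rewrite unfold-reverse q Q =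
  Descending-∷ʳ (reverse Q) (Ascending-reverse Q asc) y<q

reverse-middle : ∀ P (y : ℕ) Q → reverse (P ++ y ∷ Q) ≡ reverse Q ++ y ∷ reverse P
reverse-middle P y Q = trans (reverse-++ P (y ∷ Q))
  (trans (cong (_++ reverse P) (unfold-reverse y Q)) (++-assoc (reverse Q) [ y ] (reverse P)))

incSuffix-∈⁺ : ∀ P {y Q} → Ascending (y ∷ Q) → y ∈ incSuffix (P ++ y ∷ Q)
incSuffix-∈⁺ P {y} {Q} asc rewrite reverse-middle P y Q =
  Any.reverse⁺ (decPrefix-∈⁺ (reverse Q) (reverse P) (Ascending-reverse Q asc))

incSuffix-∈⁻ : ∀ W {y} → y ∈ incSuffix W → ∃₂ λ P Q → W ≡ P ++ y ∷ Q × All (y <_) Q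
incSuffix-∈⁻ W {y} y∈ with D₁ , D₂ , eq , above ← decPrefix-∈⁻ (reverse W) (Any.reverse⁻ y∈) =
  reverse D₂ , reverse D₁ ,
  trans (sym (reverse-involutive W)) (trans (cong reverse eq) (reverse-middle D₁ y D₂)) ,
  All.tabulate (All.lookup above ∘ Any.reverse⁻)

-- The letters frozen by φ″

RIXβ : List ℕ → List ℕ
RIXβ β = filterᵇ (geq (head β)) (incSuffix β)

IsFinal : ℕ → List ℕ → Set
IsFinal x β = head β ≡ just x ⊎ x ∈ RIXβ β

∈-filterᵇ⁺ : ∀ (p : ℕ → Bool) {x xs} → x ∈ xs → p x ≡ true → x ∈ filterᵇ p xs
∈-filterᵇ⁺ p x∈ px = ∈-filter⁺ (T? ∘ p) x∈ (Equivalence.from T-≡ px)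

∈-filterᵇ⁻ : ∀ (p : ℕ → Bool) {x xs} → x ∈ filterᵇ p xs → x ∈ xs × p x ≡ true
∈-filterᵇ⁻ p x∈ with x∈xs , px ← ∈-filter⁻ (T? ∘ p) x∈ = x∈xs , Equivalence.to T-≡ px

≤⇒geq : ∀ {m y} → m ≤ y → geq (just m) y ≡ true
≤⇒geq m≤y rewrite ≮⇒<ᵇ≡false (≤⇒≯ m≤y) = refl

geq⇒≤ : ∀ {m y} → geq (just m) y ≡ true → m ≤ y
geq⇒≤ {m} {y} _ with y <ᵇ m in y<m
... | false = ≮⇒≥ (<ᵇ≡false⇒≮ y<m)

headTop⇒next< : ∀ {m z} → Unique (m ∷ z) → DescentTop m (m ∷ z) → ∃₂ λ s Q → z ≡ s ∷ Q × s < m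
headTop⇒next< uW top with DescentTop-∷⁻ top
... | inj₁ (_ , next) = next
... | inj₂ top′       = ⊥-elim (Unique-middle-∉ʳ [] uW (DescentTop⇒∈ top′))

RIXβ-headTop⁺ : ∀ {m z} → Unique (m ∷ z) → IsGreatestTop m (m ∷ z) →
  ∀ {y} → y ∈ z → m < y → y ∈ RIXβ (m ∷ z)
RIXβ-headTop⁺ {m} uW (_ , greatest) y∈z m<y with z₁ , z₂ , refl ← ∈-∃++ y∈z =
  ∈-filterᵇ⁺ (geq (just m))
    (incSuffix-∈⁺ (m ∷ z₁) (ascending-above-tops (m ∷ z₁) uW (λ t d → ≤-<-trans (greatest t d) m<y)))
    (≤⇒geq (<⇒≤ m<y))

RIXβ-headTop⁻ : ∀ {m z} → Unique (m ∷ z) → DescentTop m (m ∷ z) →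
  ∀ {y} → y ∈ RIXβ (m ∷ z) → y ∈ z × m < y
RIXβ-headTop⁻ {m} {z} uW top y∈ with y∈inc , m≤y ← ∈-filterᵇ⁻ (geq (just m)) y∈ =
  from-split (geq⇒≤ m≤y) (incSuffix-∈⁻ (m ∷ z) y∈inc)
  where
  from-split : ∀ {y} → m ≤ y → ∃₂ (λ P Q → m ∷ z ≡ P ++ y ∷ Q × All (y <_) Q) → y ∈ z × m < y
  from-split _ ([] , Q , refl , above) with s , _ , refl , s<m ← headTop⇒next< uW top =
    ⊥-elim (<-asym s<m (All.lookup above (here refl)))
  from-split {y} m≤y (_ ∷ P , Q , eq , _) =
    y∈z , ≤∧≢⇒< m≤y (λ m≡y → Unique-middle-∉ʳ [] uW (subst (_∈ z) (sym m≡y) y∈z))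
    where
    y∈z : y ∈ z
    y∈z = subst (y ∈_) (sym (proj₂ (∷-injective eq))) (∈-++⁺ʳ P (here refl))

RIXβ-headTop : ∀ {m z} → Unique (m ∷ z) → IsGreatestTop m (m ∷ z) →
  ∀ y → (y ∈ RIXβ (m ∷ z)) ⇔ (y ∈ z × m < y)
RIXβ-headTop uW gm y = mk⇔ (RIXβ-headTop⁻ uW (proj₁ gm)) λ (y∈z , m<y) → RIXβ-headTop⁺ uW gm y∈z m<y

NoDescent⇒IsFinal : ∀ {W x} → Unique W → NoDescent W → x ∈ W → IsFinal x W
NoDescent⇒IsFinal {W} {x} uW none x∈W with ∈-∃++ x∈W
... | [] , Q , refl = inj₁ refl
... | p ∷ P , Q , refl = inj₂ (∈-filterᵇ⁺ (geq (just p)) (incSuffix-∈⁺ (p ∷ P) run) (≤⇒geq (<⇒≤ p<x)))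
  where
  run : Ascending (x ∷ Q)
  run = ascending-above-tops (p ∷ P) uW (λ t d → ⊥-elim (none t d))
  p<x : p < x
  p<x = All.lookup (Ascending⇒All< (ascending-above-tops [] uW (λ t d → ⊥-elim (none t d))))
                   (∈-++⁺ʳ P (here refl))

final-above-tops : ∀ f W {x} → Unique W → x ∈ W → length W ≤ f →
  (∀ t → DescentTop t W → t < x) → IsFinal x (proj₂ (rixAux f W))
final-above-tops zero    (_ ∷ _) _ _ () _
final-above-tops (suc f) W {x} uW x∈W len below with NoDescent⊎greatestTop W
... | inj₁ none rewrite rixAux-NoDescent f none = NoDescent⇒IsFinal uW none x∈W
... | inj₂ (m , gm) with DescentTop-split (proj₁ gm)
...   | [] , _ , _ , refl , _ rewrite rixAux-greatestTop-first f gm with x∈W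
...     | here refl = ⊥-elim (<-irrefl refl (below m (proj₁ gm)))
...     | there x∈v = inj₂ (RIXβ-headTop⁺ uW gm x∈v (below m (proj₁ gm)))
final-above-tops (suc f) _ {x} uW x∈W len below | inj₂ (m , gm) | a ∷ u , s , Q , refl , _
  rewrite rixAux-greatestTop-cut f (a ∷ u) (Unique-middle-∉ˡ (a ∷ u) uW) (λ ()) gm =
  final-above-tops f (s ∷ Q) (Unique-after-middle (a ∷ u) uW) x∈v (≤-length-after (a ∷ u) len)
    (λ t d → below t (DescentTop-++⁺ (a ∷ u) (later d)))
  where
  m<x : m < x
  m<x = below m (proj₁ gm)
  x∈v : x ∈ s ∷ Q
  x∈v with ∈-++⁻ (a ∷ u) x∈W
  ... | inj₁ x∈u          = ⊥-elim (<-asym (All.lookup (before-greatestTop-< (a ∷ u) uW (proj₂ gm)) x∈u) m<x)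
  ... | inj₂ (here refl)  = ⊥-elim (<-irrefl refl m<x)
  ... | inj₂ (there x∈v′) = x∈v′

-- Rearranging a block of small letters

LastAbove : ℕ → List ℕ → Set
LastAbove x []          = ⊤
LastAbove x (a ∷ [])    = x < a
LastAbove x (_ ∷ b ∷ A) = LastAbove x (b ∷ A)

HeadAbove : ℕ → List ℕ → Set
HeadAbove x []      = ⊤
HeadAbove x (c ∷ _) = x < c

LastAbove-tail : ∀ {x} a A → LastAbove x (a ∷ A) → LastAbove x A
LastAbove-tail a []      _   = tt
LastAbove-tail a (_ ∷ _) lst = lst

LastAbove-++⁻ : ∀ {x} P {Q} → LastAbove x (P ++ Q) → LastAbove x Q
LastAbove-++⁻ []      lst = lst
LastAbove-++⁻ (p ∷ P) {Q} lst = LastAbove-++⁻ P (LastAbove-tail p (P ++ Q) lst)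

LastAbove-∷ʳ : ∀ {x h} P → x < h → LastAbove x (P ++ [ h ])
LastAbove-∷ʳ []          x<h = x<h
LastAbove-∷ʳ (_ ∷ [])    x<h = x<h
LastAbove-∷ʳ (_ ∷ q ∷ P) x<h = LastAbove-∷ʳ (q ∷ P) x<h

LastAbove⇒¬All< : ∀ {x} a A → LastAbove x (a ∷ A) → ¬ All (_< x) (a ∷ A)
LastAbove⇒¬All< a []      x<a (a<x ∷ _)   = <-asym x<a a<x
LastAbove⇒¬All< a (b ∷ A) lst (_ ∷ below) = LastAbove⇒¬All< b A lst below

AtAnEnd : ℕ → List ℕ → Set
AtAnEnd x B = (∃ λ w → B ≡ x ∷ w) ⊎ (∃ λ w → B ≡ w ++ [ x ])

DescentTop-skip : ∀ B {x t C} → All (_≤ x) B → x < t → DescentTop t (B ++ C) → DescentTop t C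
DescentTop-skip []      _            _   d = d
DescentTop-skip (_ ∷ B) (b≤x ∷ B≤x) x<t d with DescentTop-∷⁻ d
... | inj₁ (refl , _) = ⊥-elim (<-irrefl refl (<-≤-trans x<t b≤x))
... | inj₂ d′         = DescentTop-skip B B≤x x<t d′

-- A descent top above x is not in the block; the only one reading the block
-- is the last letter of A, followed by a letter ≤ x in either arrangement.
DescentTop-rearrange : ∀ A {x t} B B′ {C} → All (_≤ x) B → All (_≤ x) B′ → x ∈ B′ → LastAbove x A → x < t →
  DescentTop t (A ++ B ++ C) → DescentTop t (A ++ B′ ++ C)
DescentTop-rearrange [] B B′ B≤x _ x∈B′ _ x<t d = DescentTop-++⁺ B′ (DescentTop-skip B B≤x x<t d)
DescentTop-rearrange (a ∷ A) B B′ B≤x B′≤x x∈B′ lst x<t d with DescentTop-∷⁻ d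
... | inj₂ d′ = later (DescentTop-rearrange A B B′ B≤x B′≤x x∈B′ (LastAbove-tail a A lst) x<t d′)
DescentTop-rearrange (a ∷ []) B (b′ ∷ B′) _ (b′≤x ∷ _) _ x<a _ _ | inj₁ (refl , _) = this (≤-<-trans b′≤x x<a)
DescentTop-rearrange (a ∷ a₂ ∷ A) B B′ _ _ _ _ _ _ | inj₁ (refl , s , Q , eq , s<t)
  with refl , _ ← ∷-injective eq = this s<t

IsGreatestTop-rearrange : ∀ A B B′ C {x m} → All (_≤ x) B → All (_≤ x) B′ → x ∈ B → x ∈ B′ →
  LastAbove x A → x < m → IsGreatestTop m (A ++ B ++ C) → IsGreatestTop m (A ++ B′ ++ C)
IsGreatestTop-rearrange A B B′ C {x} {m} B≤x B′≤x x∈B x∈B′ lst x<m (top , greatest) =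
  DescentTop-rearrange A B B′ B≤x B′≤x x∈B′ lst x<m top , below-m
  where
  below-m : ∀ t → DescentTop t (A ++ B′ ++ C) → t ≤ m
  below-m t d with x <? t
  ... | yes x<t = greatest t (DescentTop-rearrange A B′ B B′≤x B≤x x∈B lst x<t d)
  ... | no  x≮t = ≤-trans (≮⇒≥ x≮t) (<⇒≤ x<m)

∉-block-split : ∀ (A B C u : List X) {m v} → m ∉ B → A ++ B ++ C ≡ u ++ m ∷ v →
  (∃ λ A₂ → A ≡ u ++ m ∷ A₂) ⊎ (∃ λ C₀ → C ≡ C₀ ++ m ∷ v × u ≡ A ++ B ++ C₀)
∉-block-split [] [] C u _ eq = inj₂ (u , eq , refl)
∉-block-split [] (b ∷ B) C [] m∉B eq with refl , _ ← ∷-injective eq = ⊥-elim (m∉B (here refl))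
∉-block-split [] (b ∷ B) C (_ ∷ u) m∉B eq with refl , eq′ ← ∷-injective eq
  with ∉-block-split [] B C u (m∉B ∘ there) eq′
... | inj₁ (_ , []≡) = ⊥-elim ([]≢++∷ u []≡)
... | inj₂ (C₀ , eqC , equ) = inj₂ (C₀ , eqC , cong (b ∷_) equ)
∉-block-split (a ∷ A) B C [] _ eq with refl , _ ← ∷-injective eq = inj₁ (A , refl)
∉-block-split (a ∷ A) B C (_ ∷ u) m∉B eq with refl , eq′ ← ∷-injective eq
  with ∉-block-split A B C u m∉B eq′
... | inj₁ (A₂ , eqA) = inj₁ (A₂ , cong (a ∷_) eqA)
... | inj₂ (C₀ , eqC , equ) = inj₂ (C₀ , eqC , cong (a ∷_) equ)

record RixAgree (x : ℕ) (r r′ : List (List ℕ) × List ℕ) : Set where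
  field
    factors : ∀ pre αk post → factorsOf r ≡ pre ++ αk ∷ post → x ∈ αk →
              ∃ λ α′ → α′ ↭ αk × factorsOf r′ ≡ pre ++ α′ ∷ post
    β₁-≡    : head (proj₂ r′) ≡ head (proj₂ r)
    RIX-⇔   : ∀ y → (y ∈ RIXβ (proj₂ r′)) ⇔ (y ∈ RIXβ (proj₂ r))

RixAgree-refl : ∀ {x} r → RixAgree x r r
RixAgree-refl r = record
  { factors = λ _ αk _ eq _ → αk , ↭-refl , eq
  ; β₁-≡    = refl
  ; RIX-⇔   = λ _ → ⇔-id _
  }

RixAgree-∷ : ∀ {x α r r′} → x ∉ α → RixAgree x r r′ → RixAgree x (α ∷ᶠ r) (α ∷ᶠ r′)
RixAgree-∷ {x} {α} {r} {r′} x∉α agree = record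
  { factors = factors′
  ; β₁-≡    = RixAgree.β₁-≡ agree
  ; RIX-⇔   = RixAgree.RIX-⇔ agree
  }
  where
  factors′ : ∀ pre αk post → α ∷ factorsOf r ≡ pre ++ αk ∷ post → x ∈ αk →
             ∃ λ α′ → α′ ↭ αk × α ∷ factorsOf r′ ≡ pre ++ α′ ∷ post
  factors′ [] αk post eq x∈αk with refl , _ ← ∷-injective eq = ⊥-elim (x∉α x∈αk)
  factors′ (_ ∷ pre) αk post eq x∈αk with refl , eq′ ← ∷-injective eq
    with α′ , α′↭αk , eq″ ← RixAgree.factors agree pre αk post eq′ x∈αk =
    α′ , α′↭αk , cong (α ∷_) eq″

RixAgree-head : ∀ {x α α′ r} → α′ ↭ α → x ∉ concat (factorsOf r) → RixAgree x (α ∷ᶠ r) (α′ ∷ᶠ r)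
RixAgree-head {x} {α} {α′} {r} α′↭α x∉rest = record
  { factors = factors′
  ; β₁-≡    = refl
  ; RIX-⇔   = λ _ → ⇔-id _
  }
  where
  factors′ : ∀ pre αk post → α ∷ factorsOf r ≡ pre ++ αk ∷ post → x ∈ αk →
             ∃ λ α″ → α″ ↭ αk × α′ ∷ factorsOf r ≡ pre ++ α″ ∷ post
  factors′ [] αk post eq _ with refl , eq′ ← ∷-injective eq = α′ , α′↭α , cong (α′ ∷_) eq′
  factors′ (_ ∷ pre) αk post eq x∈αk with refl , eq′ ← ∷-injective eq =
    ⊥-elim (x∉rest (∈-concat⁺′ x∈αk (subst (αk ∈_) (sym eq′) (∈-++⁺ʳ pre (here refl)))))

RixAgree-β : ∀ {x W W′} → W′ ↭ W → head W′ ≡ head W → (∀ y → (y ∈ RIXβ W′) ⇔ (y ∈ RIXβ W)) →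
             RixAgree x ([] , W) ([] , W′)
RixAgree-β {x} {W} {W′} W′↭W same-head same-RIX = record
  { factors = factors′
  ; β₁-≡    = same-head
  ; RIX-⇔   = same-RIX
  }
  where
  factors′ : ∀ pre αk post → [ W ] ≡ pre ++ αk ∷ post → x ∈ αk →
             ∃ λ α′ → α′ ↭ αk × [ W′ ] ≡ pre ++ α′ ∷ post
  factors′ [] αk post eq _ with refl , refl ← ∷-injective eq = W′ , W′↭W , refl
  factors′ (_ ∷ pre) αk post eq _ = ⊥-elim ([]≢++∷ pre (proj₂ (∷-injective eq)))

¬IsFinal⇒greatestTop-≥ : ∀ f W {x} → Unique W → x ∈ W → length W ≤ suc f →
  ¬ IsFinal x (proj₂ (rixAux (suc f) W)) → ∃ λ m → IsGreatestTop m W × x ≤ m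
¬IsFinal⇒greatestTop-≥ f W {x} uW x∈W len notFinal with NoDescent⊎greatestTop W
... | inj₁ none = ⊥-elim (notFinal (final-above-tops (suc f) W uW x∈W len λ t d → ⊥-elim (none t d)))
... | inj₂ (m , gm) with m <? x
...   | yes m<x =
  ⊥-elim (notFinal (final-above-tops (suc f) W uW x∈W len λ t d → ≤-<-trans (proj₂ gm t d) m<x))
...   | no  m≮x = m , gm , ≮⇒≥ m≮x

module _ {x : ℕ} {B B′ : List ℕ} (B′↭B : B′ ↭ B) (x∈B : x ∈ B) (B≤x : All (_≤ x) B) where

  private
    x∈B′ : x ∈ B′
    x∈B′ = ∈-resp-↭ (↭-sym B′↭B) x∈B

    x∈block : ∀ A C → x ∈ A ++ B ++ C
    x∈block A C = ∈-++⁺ʳ A (∈-++⁺ˡ x∈B)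

    Unique-rearrange : ∀ A C → Unique (A ++ B ++ C) → Unique (A ++ B′ ++ C)
    Unique-rearrange A C = Unique-resp-↭ (++⁺ˡ A (++⁺ʳ C (↭-sym B′↭B)))

    greatestTop-rearrange : ∀ A C {m} → LastAbove x A → x < m →
      IsGreatestTop m (A ++ B ++ C) → IsGreatestTop m (A ++ B′ ++ C)
    greatestTop-rearrange A C =
      IsGreatestTop-rearrange A B B′ C B≤x (All-resp-↭ (↭-sym B′↭B) B≤x) x∈B x∈B′

    ++-∷ʳ-regroup : ∀ A w C → A ++ (w ++ [ x ]) ++ C ≡ (A ++ w) ++ x ∷ C
    ++-∷ʳ-regroup A w C = trans (cong (A ++_) (++-assoc w [ x ] C)) (sym (++-assoc A w (x ∷ C)))

  Agrees : ℕ → List ℕ → List ℕ → Set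
  Agrees f A C = RixAgree x (rixAux f (A ++ B ++ C)) (rixAux f (A ++ B′ ++ C))

  NotFinal : ℕ → List ℕ → List ℕ → Set
  NotFinal f A C = ¬ IsFinal x (proj₂ (rixAux f (A ++ B ++ C)))

  -- If x ends the block, the letter after it exceeds x; if x starts the block,
  -- a nonempty A would lie below the greatest top x, yet A ends above x.
  greatestTop-x⇒first : ∀ A C {u s Q} → AtAnEnd x B → Unique (A ++ B ++ C) → LastAbove x A → HeadAbove x C →
    IsGreatestTop x (A ++ B ++ C) → A ++ B ++ C ≡ u ++ x ∷ s ∷ Q → s < x → u ≡ []
  greatestTop-x⇒first A C {u} (inj₁ (w , refl)) uW lastA headC (_ , greatest) eqW s<x
    with refl , _ ← ++-cancel-at-∉ A u (Unique-middle-∉ˡ A uW) (Unique-middle-∉ˡ u (subst Unique eqW uW)) eqW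
    with A
  ... | []     = refl
  ... | a ∷ A′ = ⊥-elim (LastAbove⇒¬All< a A′ lastA (before-greatestTop-< (a ∷ A′) (subst Unique eqW uW)
                     (λ t d → greatest t (subst (DescentTop t) (sym eqW) d))))
  greatestTop-x⇒first A C {u} (inj₂ (w , refl)) uW lastA headC _ eqW s<x
    with _ , refl ← ++-cancel-at-∉ (A ++ w) u (Unique-middle-∉ˡ (A ++ w) (subst Unique (++-∷ʳ-regroup A w C) uW))
                      (Unique-middle-∉ˡ u (subst Unique eqW uW)) (trans (sym (++-∷ʳ-regroup A w C)) eqW) =
    ⊥-elim (<-asym headC s<x)

  rixAux-rearrange : ∀ f A C → AtAnEnd x B → Unique (A ++ B ++ C) → LastAbove x A → HeadAbove x C →
    length (A ++ B ++ C) ≤ f → NotFinal f A C → Agrees f A C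

  rearrange-top-before : ∀ f u A₂ C {m} → AtAnEnd x B → Unique ((u ++ m ∷ A₂) ++ B ++ C) →
    LastAbove x (u ++ m ∷ A₂) → HeadAbove x C → x < m → IsGreatestTop m ((u ++ m ∷ A₂) ++ B ++ C) →
    length ((u ++ m ∷ A₂) ++ B ++ C) ≤ suc f → NotFinal (suc f) (u ++ m ∷ A₂) C → Agrees (suc f) (u ++ m ∷ A₂) C
  rearrange-top-before f [] A₂ C {m} _ uW lastA _ x<m gm _ _
    rewrite rixAux-greatestTop-first f gm
          | rixAux-greatestTop-first f (greatestTop-rearrange (m ∷ A₂) C lastA x<m gm) =
    RixAgree-β (prep m v′↭v) refl same-RIX
    where
    v′↭v : A₂ ++ B′ ++ C ↭ A₂ ++ B ++ C
    v′↭v = ++⁺ˡ A₂ (++⁺ʳ C B′↭B)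
    gm′ : IsGreatestTop m (m ∷ A₂ ++ B′ ++ C)
    gm′ = greatestTop-rearrange (m ∷ A₂) C lastA x<m gm
    uW′ : Unique (m ∷ A₂ ++ B′ ++ C)
    uW′ = Unique-rearrange (m ∷ A₂) C uW
    same-RIX : ∀ y → (y ∈ RIXβ (m ∷ A₂ ++ B′ ++ C)) ⇔ (y ∈ RIXβ (m ∷ A₂ ++ B ++ C))
    same-RIX y = ⇔-sym (RIXβ-headTop uW gm y)
      ⇔-∘ ((mk⇔ (∈-resp-↭ v′↭v) (∈-resp-↭ (↭-sym v′↭v)) ×-⇔ ⇔-id _) ⇔-∘ RIXβ-headTop uW′ gm′ y)
  rearrange-top-before f u@(_ ∷ _) A₂ C {m} x-end uW lastA headC x<m gm len notFinal =
    subst₂ (RixAgree x) (sym (cut B uW gm)) (sym (cut B′ (Unique-rearrange (u ++ m ∷ A₂) C uW) gm′))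
      (RixAgree-∷ x∉factor (rixAux-rearrange f A₂ C x-end (Unique-after-middle u uWv)
        (LastAbove-tail m A₂ (LastAbove-++⁻ u lastA)) headC
        (≤-length-after u (subst (λ w → length w ≤ suc f) (regroup B) len))
        (notFinal ∘ subst (IsFinal x ∘ proj₂) (sym (cut B uW gm)))))
    where
    regroup : ∀ B₀ → (u ++ m ∷ A₂) ++ B₀ ++ C ≡ u ++ m ∷ A₂ ++ B₀ ++ C
    regroup B₀ = ++-assoc u (m ∷ A₂) (B₀ ++ C)
    cut : ∀ B₀ → Unique ((u ++ m ∷ A₂) ++ B₀ ++ C) → IsGreatestTop m ((u ++ m ∷ A₂) ++ B₀ ++ C) →
          rixAux (suc f) ((u ++ m ∷ A₂) ++ B₀ ++ C) ≡ (u ++ [ m ]) ∷ᶠ rixAux f (A₂ ++ B₀ ++ C)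
    cut B₀ uW₀ gm₀ = trans (cong (rixAux (suc f)) (regroup B₀))
      (rixAux-greatestTop-cut f u (Unique-middle-∉ˡ u (subst Unique (regroup B₀) uW₀)) (λ ())
        (subst (IsGreatestTop m) (regroup B₀) gm₀))
    gm′ : IsGreatestTop m ((u ++ m ∷ A₂) ++ B′ ++ C)
    gm′ = greatestTop-rearrange (u ++ m ∷ A₂) C lastA x<m gm
    uWv : Unique (u ++ m ∷ A₂ ++ B ++ C)
    uWv = subst Unique (regroup B) uW
    x∉factor : x ∉ u ++ [ m ]
    x∉factor x∈ with ∈-++⁻ u x∈
    ... | inj₁ x∈u        = Unique-++⇒disjoint u uWv x∈u (there (x∈block A₂ C))
    ... | inj₂ (here refl) = <-irrefl refl x<m

  rearrange-top-after : ∀ f A C₀ {m s Q} → Unique (A ++ B ++ C₀ ++ m ∷ s ∷ Q) → LastAbove x A → x < m →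
    IsGreatestTop m (A ++ B ++ C₀ ++ m ∷ s ∷ Q) → Agrees (suc f) A (C₀ ++ m ∷ s ∷ Q)
  rearrange-top-after f A C₀ {m} {s} {Q} uW lastA x<m gm =
    subst₂ (RixAgree x) (sym (cut B uW gm x∈B))
      (sym (cut B′ (Unique-rearrange A C uW) (greatestTop-rearrange A C lastA x<m gm) x∈B′))
      (RixAgree-head (++⁺ʳ [ m ] (++⁺ˡ A (++⁺ʳ C₀ B′↭B))) x∉rest)
    where
    C : List ℕ
    C = C₀ ++ m ∷ s ∷ Q
    regroup : ∀ B₀ → A ++ B₀ ++ C ≡ (A ++ B₀ ++ C₀) ++ m ∷ s ∷ Q
    regroup B₀ = trans (cong (A ++_) (sym (++-assoc B₀ C₀ (m ∷ s ∷ Q))))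
                       (sym (++-assoc A (B₀ ++ C₀) (m ∷ s ∷ Q)))
    cut : ∀ B₀ → Unique (A ++ B₀ ++ C) → IsGreatestTop m (A ++ B₀ ++ C) → x ∈ B₀ →
          rixAux (suc f) (A ++ B₀ ++ C) ≡ ((A ++ B₀ ++ C₀) ++ [ m ]) ∷ᶠ rixAux f (s ∷ Q)
    cut B₀ uW₀ gm₀ x∈B₀ = trans (cong (rixAux (suc f)) (regroup B₀))
      (rixAux-greatestTop-cut f (A ++ B₀ ++ C₀) (Unique-middle-∉ˡ _ (subst Unique (regroup B₀) uW₀))
        (∈⇒≢[] (∈-++⁺ʳ A (∈-++⁺ˡ x∈B₀))) (subst (IsGreatestTop m) (regroup B₀) gm₀))
    x∉rest : x ∉ concat (factorsOf (rixAux f (s ∷ Q)))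
    x∉rest x∈ = Unique-++⇒disjoint (A ++ B ++ C₀) (subst Unique (regroup B) uW) (x∈block A C₀)
                  (there (subst (x ∈_) (concat-rixAux f (s ∷ Q)) x∈))

  rixAux-rearrange zero A C _ _ _ _ len _ = ⊥-elim (<-irrefl refl (<-≤-trans (∈⇒0<length (x∈block A C)) len))
  rixAux-rearrange (suc f) A C x-end uW lastA headC len notFinal
    with m , gm , x≤m ← ¬IsFinal⇒greatestTop-≥ f (A ++ B ++ C) uW (x∈block A C) len notFinal
    with u , s , Q , eqW , s<m ← DescentTop-split (proj₁ gm)
    with m≤n⇒m<n∨m≡n x≤m
  ... | inj₂ refl with refl ← greatestTop-x⇒first A C x-end uW lastA headC gm eqW s<m =
    ⊥-elim (notFinal (inj₁ (cong (head ∘ proj₂)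
      (trans (cong (rixAux (suc f)) eqW) (rixAux-greatestTop-first f (subst (IsGreatestTop x) eqW gm))))))
  ... | inj₁ x<m with ∉-block-split A B C u (λ m∈B → <⇒≱ x<m (All.lookup B≤x m∈B)) eqW
  ...   | inj₁ (A₂ , refl)        = rearrange-top-before f u A₂ C x-end uW lastA headC x<m gm len notFinal
  ...   | inj₂ (C₀ , refl , refl) = rearrange-top-after f A C₀ uW lastA x<m gm

-- φ′ as a block swap

record BlockSwap (x : ℕ) (σ τ : List ℕ) : Set where
  field
    A B B′ C : List ℕ
    σ≡       : σ ≡ A ++ B ++ C
    τ≡       : τ ≡ A ++ B′ ++ C
    B′↭B     : B′ ↭ B
    x∈B      : x ∈ B
    B≤x      : All (_≤ x) B
    x-end    : AtAnEnd x B
    lastA    : LastAbove x A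
    headC    : HeadAbove x C

HeadAbove-dropWhile : ∀ x R → x ∉ R → HeadAbove x (dropWhileᵇ (_<ᵇ x) R)
HeadAbove-dropWhile x []      _   = tt
HeadAbove-dropWhile x (r ∷ R) x∉R with r <ᵇ x in r<x
... | true  = HeadAbove-dropWhile x R (x∉R ∘ there)
... | false = ≤∧≢⇒< (≮⇒≥ (<ᵇ≡false⇒≮ r<x)) (x∉R ∘ here)

HeadAbove-reverse : ∀ {x} D → HeadAbove x D → LastAbove x (reverse D)
HeadAbove-reverse []      _   = tt
HeadAbove-reverse (d ∷ D) x<d rewrite unfold-reverse d D = LastAbove-∷ʳ (reverse D) x<d

rightGreater⇒takeWhile≡[] : ∀ x R → rightGreater x (head R) ≡ true → takeWhileᵇ (_<ᵇ x) R ≡ []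
rightGreater⇒takeWhile≡[] x []      _   = refl
rightGreater⇒takeWhile≡[] x (r ∷ R) x<r rewrite ≮⇒<ᵇ≡false (<⇒≯ (<ᵇ≡true⇒< {x} {r} x<r)) = refl

last-∷ʳ : ∀ (xs : List X) a → last (xs ++ [ a ]) ≡ just a
last-∷ʳ []           a = refl
last-∷ʳ (_ ∷ [])     a = refl
last-∷ʳ (_ ∷ y ∷ xs) a = last-∷ʳ (y ∷ xs) a

last≡head-reverse : ∀ (xs : List X) → last xs ≡ head (reverse xs)
last≡head-reverse xs = trans (cong last (sym (reverse-involutive xs))) (last-reverse (reverse xs))
  where
  last-reverse : ∀ (ys : List X) → last (reverse ys) ≡ head ys
  last-reverse []       = refl
  last-reverse (y ∷ ys) rewrite unfold-reverse y ys = last-∷ʳ (reverse ys) y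

∧-∨-∧≡true⇒ : ∀ a b c d → (a ∧ b) ∨ (c ∧ d) ≡ true → b ≡ true ⊎ c ≡ true
∧-∨-∧≡true⇒ _     true  _     _ _  = inj₁ refl
∧-∨-∧≡true⇒ _     false true  _ _  = inj₂ refl
∧-∨-∧≡true⇒ true  false false _ ()
∧-∨-∧≡true⇒ false false false _ ()

leftGreater≗rightGreater : ∀ x l → leftGreater x l ≡ rightGreater x l
leftGreater≗rightGreater x nothing  = refl
leftGreater≗rightGreater x (just _) = refl

leftGreater-last : ∀ x L → leftGreater x (last L) ≡ rightGreater x (head (reverse L))
leftGreater-last x L =
  trans (cong (leftGreater x) (last≡head-reverse L)) (leftGreater≗rightGreater x (head (reverse L)))

module MoveBlocks (x : ℕ) (L R : List ℕ) where

  w₁ w₂ w₃ w₄ : List ℕ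
  w₁ = reverse (dropWhileᵇ (_<ᵇ x) (reverse L))
  w₂ = reverse (takeWhileᵇ (_<ᵇ x) (reverse L))
  w₃ = takeWhileᵇ (_<ᵇ x) R
  w₄ = dropWhileᵇ (_<ᵇ x) R

  private
    takeWhile++dropWhile-small : ∀ W → takeWhileᵇ (_<ᵇ x) W ++ dropWhileᵇ (_<ᵇ x) W ≡ W
    takeWhile++dropWhile-small = takeWhile++dropWhile (T? ∘ (_<ᵇ x))

    w₂-small : All (_< x) w₂
    w₂-small = All.tabulate λ {y} y∈ →
      <ᵇ⇒< y x (All.lookup (All.all-takeWhile (T? ∘ (_<ᵇ x)) (reverse L)) (Any.reverse⁻ y∈))

    w₃-small : All (_< x) w₃
    w₃-small = All.map (λ {y} → <ᵇ⇒< y x) (All.all-takeWhile (T? ∘ (_<ᵇ x)) R)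

  L≡ : L ≡ w₁ ++ w₂
  L≡ = begin
    L                     ≡⟨ reverse-involutive L ⟨
    reverse (reverse L)   ≡⟨ cong reverse (takeWhile++dropWhile-small (reverse L)) ⟨
    reverse (takeWhileᵇ (_<ᵇ x) (reverse L) ++ dropWhileᵇ (_<ᵇ x) (reverse L))
                          ≡⟨ reverse-++ (takeWhileᵇ (_<ᵇ x) (reverse L)) _ ⟩
    w₁ ++ w₂              ∎

  word≡ : L ++ x ∷ R ≡ w₁ ++ (w₂ ++ x ∷ w₃) ++ w₄
  word≡ = begin
    L ++ x ∷ R                  ≡⟨ cong₂ (λ L′ R′ → L′ ++ x ∷ R′) L≡ (sym (takeWhile++dropWhile-small R)) ⟩
    (w₁ ++ w₂) ++ x ∷ w₃ ++ w₄  ≡⟨ ++-assoc w₁ w₂ (x ∷ w₃ ++ w₄) ⟩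
    w₁ ++ w₂ ++ x ∷ w₃ ++ w₄    ≡⟨ cong (w₁ ++_) (++-assoc w₂ (x ∷ w₃) w₄) ⟨
    w₁ ++ (w₂ ++ x ∷ w₃) ++ w₄  ∎

  swapped≡ : w₁ ++ w₃ ++ x ∷ w₂ ++ w₄ ≡ w₁ ++ (w₃ ++ x ∷ w₂) ++ w₄
  swapped≡ = cong (w₁ ++_) (sym (++-assoc w₃ (x ∷ w₂) w₄))

  swap↭ : w₃ ++ x ∷ w₂ ↭ w₂ ++ x ∷ w₃
  swap↭ = ↭-trans (↭-++-comm w₃ (x ∷ w₂)) (↭-sym (shift x w₂ w₃))

  block≤x : All (_≤ x) (w₂ ++ x ∷ w₃)
  block≤x = All.++⁺ (All.map <⇒≤ w₂-small) (≤-refl ∷ All.map <⇒≤ w₃-small)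

  x-end : (leftLess x (last L) ∧ rightGreater x (head R)) ∨ (leftGreater x (last L) ∧ rightLess x (head R))
          ≡ true → AtAnEnd x (w₂ ++ x ∷ w₃)
  x-end double with ∧-∨-∧≡true⇒ (leftLess x (last L)) _ _ (rightLess x (head R)) double
  ... | inj₁ ascent  = inj₂ (w₂ , cong (λ w → w₂ ++ x ∷ w) (rightGreater⇒takeWhile≡[] x R ascent))
  ... | inj₂ descent = inj₁ (w₃ , cong (λ w → reverse w ++ x ∷ w₃)
      (rightGreater⇒takeWhile≡[] x (reverse L) (trans (sym (leftGreater-last x L)) descent)))

  lastAbove-w₁ : x ∉ L → LastAbove x w₁
  lastAbove-w₁ x∉L = HeadAbove-reverse _ (HeadAbove-dropWhile x (reverse L) (x∉L ∘ Any.reverse⁻))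

move-BlockSwap : ∀ {x σ} → Unique σ → x ∈ σ → (isDoubleAscent x σ ∨ isDoubleDescent x σ) ≡ true →
                 BlockSwap x σ (move x σ)
move-BlockSwap {x} {σ} uσ x∈σ double = record
  { A     = w₁
  ; B     = w₂ ++ x ∷ w₃
  ; B′    = w₃ ++ x ∷ w₂
  ; C     = w₄
  ; σ≡    = trans σ≡LxR word≡
  ; τ≡    = swapped≡
  ; B′↭B  = swap↭
  ; x∈B   = ∈-++⁺ʳ w₂ (here refl)
  ; B≤x   = block≤x
  ; x-end = x-end double
  ; lastA = lastAbove-w₁ (Unique-middle-∉ˡ L uLxR)
  ; headC = HeadAbove-dropWhile x R (Unique-middle-∉ʳ L uLxR)
  }
  where
  L R : List ℕ
  L = proj₁ (splitAtLetter x σ)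
  R = proj₂ (splitAtLetter x σ)
  open MoveBlocks x L R
  σ≡LxR : σ ≡ L ++ x ∷ R
  σ≡LxR = splitAtLetter-∈ σ x∈σ
  uLxR : Unique (L ++ x ∷ R)
  uLxR = subst Unique σ≡LxR uσ

BlockSwap-RixAgree : ∀ {x σ τ} → Unique σ → BlockSwap x σ τ → ¬ IsFinal x (rixβ σ) → RixAgree x (rix σ) (rix τ)
BlockSwap-RixAgree {x} {σ} {τ} uσ swap notFinal =
  subst₂ (RixAgree x) (cong (rixAux (length σ)) (sym σ≡)) (sym (cong₂ rixAux same-length τ≡))
    (rixAux-rearrange B′↭B x∈B B≤x (length σ) A C x-end (subst Unique σ≡ uσ) lastA headC
      (≤-reflexive (cong length (sym σ≡)))
      (notFinal ∘ subst (IsFinal x ∘ proj₂) (cong (rixAux (length σ)) (sym σ≡))))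
  where
  open BlockSwap swap
  same-length : length τ ≡ length σ
  same-length = trans (cong length τ≡) (trans (↭-length (++⁺ˡ A (++⁺ʳ C B′↭B))) (cong length (sym σ≡)))

∈⇒elemᵇ≡true : ∀ {x l} → x ∈ l → elemᵇ x l ≡ true
∈⇒elemᵇ≡true {x}          (here refl) rewrite ≡ᵇ-refl x = refl
∈⇒elemᵇ≡true {x} {a ∷ l} (there x∈l) rewrite ∈⇒elemᵇ≡true {x} {l} x∈l = ∨-zeroʳ (a ≡ᵇ x)

IsFinal⇒frozen : ∀ {x σ} → IsFinal x (rixβ σ) → (isβ₁ x (β₁ σ) ∨ elemᵇ x (RIX σ)) ≡ true
IsFinal⇒frozen {x} {σ} (inj₁ β₁≡x) rewrite β₁≡x | ≡ᵇ-refl x = refl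
IsFinal⇒frozen {x} {σ} (inj₂ x∈RIX) rewrite ∈⇒elemᵇ≡true x∈RIX = ∨-zeroʳ (isβ₁ x (β₁ σ))

φ″-RixAgree : ∀ σ x → Unique σ → x ∈ σ → RixAgree x (rix σ) (rix (φ″ x σ))
φ″-RixAgree σ x uσ x∈σ with isβ₁ x (β₁ σ) ∨ elemᵇ x (RIX σ) in frozen
... | true = RixAgree-refl _
... | false with isDoubleAscent x σ ∨ isDoubleDescent x σ in double
...   | false = RixAgree-refl _
...   | true  = BlockSwap-RixAgree uσ (move-BlockSwap uσ x∈σ double) λ final →
                  case trans (sym (IsFinal⇒frozen {σ = σ} final)) frozen of λ ()

Unique-range : ∀ n → Unique (range n)
Unique-range n = Unique.map⁺ suc-injective (Unique.upTo⁺ n)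

lemma4p1 : (n : ℕ) (σ : List ℕ) → σ ↭ range n →
           (x : ℕ) → 1 ≤ x → x ≤ n →
           (pre : List (List ℕ)) (αk : List ℕ) (post : List (List ℕ)) →
           rixFactors σ ≡ pre ++ αk ∷ post → x ∈ αk →
           (∃ λ (α′ : List ℕ) → α′ ↭ αk × rixFactors (φ″ x σ) ≡ pre ++ α′ ∷ post)
           × β₁ (φ″ x σ) ≡ β₁ σ
           × ((y : ℕ) → (y ∈ RIX (φ″ x σ)) ⇔ (y ∈ RIX σ))
lemma4p1 n σ σ↭[n] x _ _ pre αk post factors≡ x∈αk =
  RixAgree.factors agree pre αk post factors≡ x∈αk , RixAgree.β₁-≡ agree , RixAgree.RIX-⇔ agree
  where
  x∈σ : x ∈ σ
  x∈σ = subst (x ∈_) (concat-rixAux (length σ) σ)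
          (∈-concat⁺′ x∈αk (subst (αk ∈_) (sym factors≡) (∈-++⁺ʳ pre (here refl))))
  agree : RixAgree x (rix σ) (rix (φ″ x σ))
  agree = φ″-RixAgree σ x (Unique-resp-↭ (↭-sym σ↭[n]) (Unique-range n)) x∈σ
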